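{- Let $S=\{R_0,\ldots,R_d\}$ be an association scheme on a nonempty finite set $X$, $\mathbb{F}$ a field, $x\in X$, $a\ge 0$ an integer, and $i_b,j_b,\ell_b\in\{0,\ldots,d\}$ for $b=0,\ldots,a$ with $k_{i_b}=k_{\ell_b}$ for all $b$. Let $P=E_{i_0}^*A_{j_0}E_{\ell_0}^*E_{i_1}^*A_{j_1}E_{\ell_1}^*\cdots E_{i_a}^*A_{j_a}E_{\ell_a}^*$. Then for any $r\in xR_{i_0}$ and $c\in xR_{\ell_a}$, the $r$-row sum of $P$ equals the $c$-column sum of $P$ (sums computed in $\mathbb{F}$).
   Context: An association scheme on $X$ is a partition $S=\{R_0,\ldots,R_d\}$ of $X\times X$ into nonempty relations with $R_0$ the diagonal, closed under transposes, with $p_{ij}^k=|\{\ell:(m,\ell)\in R_i,(\ell,n)\in R_j\}|$ independent of $(m,n)\in R_k$. Valency $k_a=|xR_a|$, $xR_a=\{z:(x,z)\in R_a\}$. $A_j\in M_X(\mathbb{F})$ is the $(0,1)$ adjacency matrix of $R_j$, $E_i^*$ the diagonal $(0,1)$-matrix with $(y,y)$-entry $1$ iff $y\in xR_i$. The $r$-row sum of a matrix $(m_{uv})\in M_X(\mathbb{F})$ is $\sum_{v\in X}m_{rv}$, the $c$-column sum is $\sum_{u\in X}m_{uc}$. -}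

module Defs where

open import Level using (Level; _⊔_)
open import Data.Nat using (ℕ; zero; suc) renaming (_+_ to _+ℕ_)
open import Data.Fin using (Fin; zero; suc)
open import Data.Fin.Properties using (_≟_)
open import Data.Bool using (Bool; true; false; if_then_else_)
open import Data.Product using (Σ; ∃; _×_; _,_)
open import Data.Vec using (Vec; []; _∷_)
open import Relation.Nullary using (¬_; does)
open import Relation.Binary.PropositionalEquality using (_≡_)
open import Function.Bundles using (_⇔_)
open import Algebra.Bundles using (CommutativeRing)

record Field (c ℓ : Level) : Set (Level.suc (c ⊔ ℓ)) where
  field
    commutativeRing : CommutativeRing c ℓ
  open CommutativeRing commutativeRing public
  field
    1≉0     : ¬ (1# ≈ 0#)
    inverse : ∀ x → ¬ (x ≈ 0#) → Σ Carrier λ y → (x * y) ≈ 1#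

count : {n : ℕ} → (Fin n → Bool) → ℕ
count {zero}  p = 0
count {suc n} p = (if p zero then 1 else 0) +ℕ count (λ i → p (suc i))

-- Association schemes on X = Fin n with relations R_0, …, R_d.
-- The partition of X × X is given by the function rel assigning to each
-- pair (u , v) the unique index i with (u , v) ∈ R_i.

_≡ᵇ_ : {m : ℕ} → Fin m → Fin m → Bool
i ≡ᵇ j = does (i ≟ j)

record AssociationScheme (n d : ℕ) : Set where
  field
    rel        : Fin n → Fin n → Fin (suc d)
    nonempty   : ∀ (i : Fin (suc d)) → Σ (Fin n) λ u → Σ (Fin n) λ v → rel u v ≡ i
    diagonal   : ∀ (u v : Fin n) → (rel u v ≡ zero) ⇔ (u ≡ v)
    transposed : ∀ (i : Fin (suc d)) → Σ (Fin (suc d)) λ i' →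
                   ∀ (u v : Fin n) → (rel u v ≡ i) ⇔ (rel v u ≡ i')
    intersection : ∀ (i j k : Fin (suc d)) → Σ ℕ λ p →
                   ∀ (m m' : Fin n) → rel m m' ≡ k →
                   count (λ l → (rel m l ≡ᵇ i) Data.Bool.∧ (rel l m' ≡ᵇ j)) ≡ p

open AssociationScheme public

Triple : ℕ → Set
Triple d = Fin (suc d) × Fin (suc d) × Fin (suc d)

firstI : {d a : ℕ} → Vec (Triple d) (suc a) → Fin (suc d)
firstI ((i , _ , _) ∷ _) = i

lastL : {d a : ℕ} → Vec (Triple d) (suc a) → Fin (suc d)
lastL ((_ , _ , l) ∷ [])     = l
lastL (_ ∷ u ∷ ts) = lastL (u ∷ ts)

-- valency of R_a computed at the base point x : k_a = |x R_a|
-- (independent of x by the scheme axioms)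
valencyAt : {n d : ℕ} → AssociationScheme n d → Fin n → Fin (suc d) → ℕ
valencyAt S x a = count (λ z → rel S x z ≡ᵇ a)

module Matrices {c ℓ : Level} (F : Field c ℓ) where
  open Field F using (Carrier; 0#; 1#; _+_; _*_)

  Matrix : ℕ → Set c
  Matrix n = Fin n → Fin n → Carrier

  ∑ : {n : ℕ} → (Fin n → Carrier) → Carrier
  ∑ {zero}  f = 0#
  ∑ {suc n} f = f zero + ∑ (λ i → f (suc i))

  _·_ : {n : ℕ} → Matrix n → Matrix n → Matrix n
  (M · N) u v = ∑ (λ w → M u w * N w v)

  rowSum : {n : ℕ} → Matrix n → Fin n → Carrier
  rowSum M r = ∑ (λ v → M r v)

  colSum : {n : ℕ} → Matrix n → Fin n → Carrier
  colSum M c = ∑ (λ u → M u c)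

  module _ {n d : ℕ} (S : AssociationScheme n d) where
    A : Fin (suc d) → Matrix n
    A j u v = if rel S u v ≡ᵇ j then 1# else 0#

    E* : Fin n → Fin (suc d) → Matrix n
    E* x i u v = if (u ≡ᵇ v) Data.Bool.∧ (rel S x u ≡ᵇ i) then 1# else 0#

    block : Fin n → Fin (suc d) × Fin (suc d) × Fin (suc d) → Matrix n
    block x (i , j , l) = (E* x i · A j) · E* x l

    P : {a : ℕ} → Fin n → Vec (Fin (suc d) × Fin (suc d) × Fin (suc d)) (suc a) → Matrix n
    P x (t ∷ [])     = block x t
    P x (t ∷ u ∷ ts) = block x t · P x (u ∷ ts)

-- Call M balanced from i to l with value μ if it vanishes outside the rows in x R_i and the
-- columns in x R_l (that is, M = E*_i M E*_l) and each of those rows and columns sums to μ.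
-- The block E*_i A_j E*_l has row sums p^{i'}_{j l'} and column sums p^l_{ij} (i' indexes the
-- transpose of R_i); summing all its entries in ℕ both ways gives k_i p^{i'}_{j l'} = k_l p^l_{ij},
-- so k_i = k_l makes the block balanced. This cancellation has to happen in ℕ, as k_l may vanish
-- in F. Balanced matrices compose (the values multiply when the inner indices agree, otherwise
-- the product is zero), so P is balanced and its row sum at r equals its column sum at c.

module Submission where

open import Defs
open import Level using (Level)
open import Data.Nat using (ℕ; zero; suc; _<_; >-nonZero; z<s)
  renaming (_+_ to _+ℕ_; _*_ to _*ℕ_)
open import Data.Nat.Properties using (+-*-commutativeSemiring; *-cancelˡ-≡; m≤n+m; <-≤-trans)
open import Data.Fin using (Fin; zero; suc)
open import Data.Fin.Properties using (_≟_; suc-injective)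
open import Data.Bool using (Bool; true; false; if_then_else_; _∧_)
open import Data.Product using (Σ; _,_; proj₁; proj₂)
open import Data.Vec using (Vec; lookup; []; _∷_)
open import Function using (_∘_)
open import Function.Bundles using (_⇔_; Equivalence)
open import Relation.Binary.PropositionalEquality as ≡ using (_≡_; _≢_)
open import Relation.Nullary.Decidable using (Dec; yes; no; dec-true; dec-false; does-⇔)
open import Algebra.Bundles using (CommutativeSemiring)

≡ᵇ-true : ∀ {m} {u t : Fin m} → u ≡ t → (u ≡ᵇ t) ≡ true
≡ᵇ-true {u = u} {t} = dec-true (u ≟ t)

≡ᵇ-false : ∀ {m} {u t : Fin m} → u ≢ t → (u ≡ᵇ t) ≡ false
≡ᵇ-false {u = u} {t} = dec-false (u ≟ t)

count-cong : ∀ {n} {p q : Fin n → Bool} → (∀ v → p v ≡ q v) → count p ≡ count q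
count-cong {zero}  p≗q = ≡.refl
count-cong {suc n} p≗q =
  ≡.cong₂ (λ b m → (if b then 1 else 0) +ℕ m) (p≗q zero) (count-cong (p≗q ∘ suc))

count-pos : ∀ {n} (p : Fin n → Bool) v → p v ≡ true → 0 < count p
count-pos p zero    pv rewrite pv = z<s
count-pos p (suc v) pv = <-≤-trans (count-pos (p ∘ suc) v pv) (m≤n+m _ _)

module Scheme {n d : ℕ} (S : AssociationScheme n d) where

  _ᵀ : Fin (suc d) → Fin (suc d)
  i ᵀ = proj₁ (transposed S i)

  rel-ᵀ : ∀ i u v → (rel S u v ≡ i) ⇔ (rel S v u ≡ i ᵀ)
  rel-ᵀ i = proj₂ (transposed S i)

  intersectionNumber : Fin (suc d) → Fin (suc d) → Fin (suc d) → ℕ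
  intersectionNumber i j k = proj₁ (intersection S i j k)

  count-row : ∀ x r {i} j l → rel S x r ≡ i →
    count (λ v → (rel S r v ≡ᵇ j) ∧ (rel S x v ≡ᵇ l)) ≡ intersectionNumber j (l ᵀ) (i ᵀ)
  count-row x r {i} j l xr≡i = ≡.trans
    (count-cong λ v → ≡.cong ((rel S r v ≡ᵇ j) ∧_)
      (does-⇔ (rel-ᵀ l x v) (rel S x v ≟ l) (rel S v x ≟ l ᵀ)))
    (proj₂ (intersection S j (l ᵀ) (i ᵀ)) r x (Equivalence.to (rel-ᵀ i x r) xr≡i))

module IndicatorSums {c ℓ : Level} (R : CommutativeSemiring c ℓ) where
  open CommutativeSemiring R hiding (zero)
  open import Algebra.Properties.Semiring.Sum semiring public
    using (sum; sum-cong-≋; sum-cong-≗; sum-replicate-zero; ∑-comm; *-distribˡ-sum; *-distribʳ-sum)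
  open import Algebra.Properties.Semiring.Mult semiring public
    using (_×_; ×-homo-+; ×1-homo-*)
  open import Relation.Binary.Reasoning.Setoid setoid

  𝟙 : Bool → Carrier
  𝟙 b = if b then 1# else 0#

  𝟙-∧ : ∀ a b → 𝟙 (a ∧ b) ≈ 𝟙 a * 𝟙 b
  𝟙-∧ true  b = sym (*-identityˡ (𝟙 b))
  𝟙-∧ false b = sym (zeroˡ (𝟙 b))

  sum-zero : ∀ {n} {f : Fin n → Carrier} → (∀ v → f v ≈ 0#) → sum f ≈ 0#
  sum-zero {n} f≈0 = trans (sum-cong-≋ f≈0) (sum-replicate-zero n)

  sum-single : ∀ {n} (f : Fin n → Carrier) u → (∀ t → t ≢ u → f t ≈ 0#) → sum f ≈ f u
  sum-single f zero    f≈0 =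
    trans (+-congˡ (sum-zero λ t → f≈0 (suc t) λ ())) (+-identityʳ _)
  sum-single f (suc u) f≈0 = trans
    (+-cong (f≈0 zero λ ()) (sum-single (f ∘ suc) u λ t t≢u → f≈0 (suc t) (t≢u ∘ suc-injective)))
    (+-identityˡ _)

  sum-𝟙 : ∀ {n} (p : Fin n → Bool) → sum (λ v → 𝟙 (p v)) ≈ count p × 1#
  sum-𝟙 {zero}  p = refl
  sum-𝟙 {suc n} p = begin
    𝟙 (p zero) + sum (λ v → 𝟙 (p (suc v)))    ≈⟨ +-cong (𝟙≈× (p zero)) (sum-𝟙 (p ∘ suc)) ⟩
    ind (p zero) × 1# + count (p ∘ suc) × 1#  ≈⟨ ×-homo-+ 1# (ind (p zero)) _ ⟨
    count p × 1#                              ∎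
    where
    ind : Bool → ℕ
    ind b = if b then 1 else 0
    𝟙≈× : ∀ b → 𝟙 b ≈ ind b × 1#
    𝟙≈× true  = sym (+-identityʳ 1#)
    𝟙≈× false = refl

  𝟙-true : ∀ {b} → b ≡ true → ∀ y → 𝟙 b * y ≈ y
  𝟙-true ≡.refl = *-identityˡ

  𝟙-false : ∀ {b} → b ≡ false → ∀ y → 𝟙 b * y ≈ 0#
  𝟙-false ≡.refl = zeroˡ

  𝟙-≡ᵇ-cases : ∀ {m} {a b : Fin m} {s y : Carrier} → (a ≡ b → s ≈ y) → (a ≢ b → s ≈ 0#) →
    s ≈ 𝟙 (a ≡ᵇ b) * y
  𝟙-≡ᵇ-cases {a = a} {b} {y = y} a≡b⇒ a≢b⇒ with a ≟ b
  ... | yes a≡b = trans (a≡b⇒ a≡b) (sym (*-identityˡ y))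
  ... | no  a≢b = trans (a≢b⇒ a≢b) (sym (zeroˡ y))

  module _ {n d : ℕ} (S : AssociationScheme n d) (x : Fin n) where
    open Scheme S

    blockEntry : Fin (suc d) → Fin (suc d) → Fin (suc d) → Fin n → Fin n → Carrier
    blockEntry i j l u v = 𝟙 (rel S x u ≡ᵇ i) * 𝟙 (rel S u v ≡ᵇ j) * 𝟙 (rel S x v ≡ᵇ l)

    blockEntry-outsideRow : ∀ {i} j l {u} v → rel S x u ≢ i → blockEntry i j l u v ≈ 0#
    blockEntry-outsideRow {i} j l {u} v xu≢i = trans (*-congʳ (𝟙-false (≡ᵇ-false xu≢i) _)) (zeroˡ _)

    blockEntry-outsideCol : ∀ i j {l} u {v} → rel S x v ≢ l → blockEntry i j l u v ≈ 0#
    blockEntry-outsideCol i j {l} u {v} xv≢l = trans (*-comm _ _) (𝟙-false (≡ᵇ-false xv≢l) _)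

    blockEntry-insideRow : ∀ {i} j l {u} v → rel S x u ≡ i →
      blockEntry i j l u v ≈ 𝟙 ((rel S u v ≡ᵇ j) ∧ (rel S x v ≡ᵇ l))
    blockEntry-insideRow {i} j l {u} v xu≡i = begin
      𝟙 (rel S x u ≡ᵇ i) * 𝟙 (rel S u v ≡ᵇ j) * 𝟙 (rel S x v ≡ᵇ l)  ≈⟨ *-congʳ (𝟙-true (≡ᵇ-true xu≡i) _) ⟩
      𝟙 (rel S u v ≡ᵇ j) * 𝟙 (rel S x v ≡ᵇ l)                       ≈⟨ 𝟙-∧ _ _ ⟨
      𝟙 ((rel S u v ≡ᵇ j) ∧ (rel S x v ≡ᵇ l))                       ∎

    blockEntry-insideCol : ∀ i j {l} u {v} → rel S x v ≡ l →
      blockEntry i j l u v ≈ 𝟙 ((rel S x u ≡ᵇ i) ∧ (rel S u v ≡ᵇ j))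
    blockEntry-insideCol i j {l} u {v} xv≡l = begin
      𝟙 (rel S x u ≡ᵇ i) * 𝟙 (rel S u v ≡ᵇ j) * 𝟙 (rel S x v ≡ᵇ l)    ≈⟨ *-comm _ _ ⟩
      𝟙 (rel S x v ≡ᵇ l) * (𝟙 (rel S x u ≡ᵇ i) * 𝟙 (rel S u v ≡ᵇ j))  ≈⟨ 𝟙-true (≡ᵇ-true xv≡l) _ ⟩
      𝟙 (rel S x u ≡ᵇ i) * 𝟙 (rel S u v ≡ᵇ j)                         ≈⟨ 𝟙-∧ _ _ ⟨
      𝟙 ((rel S x u ≡ᵇ i) ∧ (rel S u v ≡ᵇ j))                         ∎

    blockEntry-rowSum : ∀ {i} j l r → rel S x r ≡ i →
      sum (blockEntry i j l r) ≈ intersectionNumber j (l ᵀ) (i ᵀ) × 1#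
    blockEntry-rowSum {i} j l r xr≡i = begin
      sum (blockEntry i j l r)                                ≈⟨ sum-cong-≋ (λ v → blockEntry-insideRow j l v xr≡i) ⟩
      sum (λ v → 𝟙 ((rel S r v ≡ᵇ j) ∧ (rel S x v ≡ᵇ l)))     ≈⟨ sum-𝟙 (λ v → (rel S r v ≡ᵇ j) ∧ (rel S x v ≡ᵇ l)) ⟩
      count (λ v → (rel S r v ≡ᵇ j) ∧ (rel S x v ≡ᵇ l)) × 1#  ≡⟨ ≡.cong (_× 1#) (count-row x r j l xr≡i) ⟩
      intersectionNumber j (l ᵀ) (i ᵀ) × 1#                   ∎

    blockEntry-colSum : ∀ i j {l} c → rel S x c ≡ l →
      sum (λ u → blockEntry i j l u c) ≈ intersectionNumber i j l × 1#
    blockEntry-colSum i j {l} c xc≡l = begin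
      sum (λ u → blockEntry i j l u c)                        ≈⟨ sum-cong-≋ (λ u → blockEntry-insideCol i j u xc≡l) ⟩
      sum (λ u → 𝟙 ((rel S x u ≡ᵇ i) ∧ (rel S u c ≡ᵇ j)))     ≈⟨ sum-𝟙 (λ u → (rel S x u ≡ᵇ i) ∧ (rel S u c ≡ᵇ j)) ⟩
      count (λ u → (rel S x u ≡ᵇ i) ∧ (rel S u c ≡ᵇ j)) × 1#  ≡⟨ ≡.cong (_× 1#) (proj₂ (intersection S i j l) x c xc≡l) ⟩
      intersectionNumber i j l × 1#                           ∎

    blockEntry-rowSum-𝟙 : ∀ i j l u →
      sum (blockEntry i j l u) ≈ 𝟙 (rel S x u ≡ᵇ i) * (intersectionNumber j (l ᵀ) (i ᵀ) × 1#)
    blockEntry-rowSum-𝟙 i j l u =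
      𝟙-≡ᵇ-cases (blockEntry-rowSum j l u) (λ xu≢i → sum-zero λ v → blockEntry-outsideRow j l v xu≢i)

    blockEntry-colSum-𝟙 : ∀ i j l v →
      sum (λ u → blockEntry i j l u v) ≈ 𝟙 (rel S x v ≡ᵇ l) * (intersectionNumber i j l × 1#)
    blockEntry-colSum-𝟙 i j l v =
      𝟙-≡ᵇ-cases (blockEntry-colSum i j v) (λ xv≢l → sum-zero λ u → blockEntry-outsideCol i j u xv≢l)

    -- Double counting: the sum of all entries of blockEntry i j l, by rows and by columns.
    blockEntry-total : ∀ i j l →
      (valencyAt S x i *ℕ intersectionNumber j (l ᵀ) (i ᵀ)) × 1# ≈
      (valencyAt S x l *ℕ intersectionNumber i j l) × 1#
    blockEntry-total i j l = begin
      (valencyAt S x i *ℕ p) × 1#                   ≈⟨ ×1-homo-* (valencyAt S x i) p ⟩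
      valencyAt S x i × 1# * (p × 1#)               ≈⟨ *-congʳ (sum-𝟙 (λ u → rel S x u ≡ᵇ i)) ⟨
      sum (λ u → 𝟙 (rel S x u ≡ᵇ i)) * (p × 1#)     ≈⟨ *-distribʳ-sum (p × 1#) (λ u → 𝟙 (rel S x u ≡ᵇ i)) ⟩
      sum (λ u → 𝟙 (rel S x u ≡ᵇ i) * (p × 1#))     ≈⟨ sum-cong-≋ (blockEntry-rowSum-𝟙 i j l) ⟨
      sum (λ u → sum (λ v → blockEntry i j l u v))  ≈⟨ ∑-comm (blockEntry i j l) ⟩
      sum (λ v → sum (λ u → blockEntry i j l u v))  ≈⟨ sum-cong-≋ (blockEntry-colSum-𝟙 i j l) ⟩
      sum (λ v → 𝟙 (rel S x v ≡ᵇ l) * (q × 1#))     ≈⟨ *-distribʳ-sum (q × 1#) (λ v → 𝟙 (rel S x v ≡ᵇ l)) ⟨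
      sum (λ v → 𝟙 (rel S x v ≡ᵇ l)) * (q × 1#)     ≈⟨ *-congʳ (sum-𝟙 (λ v → rel S x v ≡ᵇ l)) ⟩
      valencyAt S x l × 1# * (q × 1#)               ≈⟨ ×1-homo-* (valencyAt S x l) q ⟨
      (valencyAt S x l *ℕ q) × 1#                   ∎
      where
      p = intersectionNumber j (l ᵀ) (i ᵀ)
      q = intersectionNumber i j l

module _ {n d : ℕ} (S : AssociationScheme n d) (x : Fin n) where
  open Scheme S
  open IndicatorSums +-*-commutativeSemiring using (_×_; blockEntry-total)

  private
    ×1≡ : ∀ m → m × 1 ≡ m
    ×1≡ zero    = ≡.refl
    ×1≡ (suc m) = ≡.cong suc (×1≡ m)

  valencyAt-*-intersectionNumber : ∀ i j l →
    valencyAt S x i *ℕ intersectionNumber j (l ᵀ) (i ᵀ) ≡ valencyAt S x l *ℕ intersectionNumber i j l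
  valencyAt-*-intersectionNumber i j l =
    ≡.trans (≡.sym (×1≡ _)) (≡.trans (blockEntry-total S x i j l) (×1≡ _))

  intersectionNumber-ᵀ : ∀ {i} j {l} c → valencyAt S x i ≡ valencyAt S x l → rel S x c ≡ l →
    intersectionNumber j (l ᵀ) (i ᵀ) ≡ intersectionNumber i j l
  intersectionNumber-ᵀ {i} j {l} c kᵢ≡kₗ xc≡l =
    *-cancelˡ-≡ _ _ (valencyAt S x l) {{>-nonZero (count-pos _ c (≡ᵇ-true xc≡l))}}
      (≡.trans (≡.cong (_*ℕ intersectionNumber j (l ᵀ) (i ᵀ)) (≡.sym kᵢ≡kₗ))
               (valencyAt-*-intersectionNumber i j l))

module _ {c ℓ : Level} (F : Field c ℓ) where
  open Field F hiding (zero)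
  open Matrices F
  open IndicatorSums commutativeSemiring
  open import Relation.Binary.Reasoning.Setoid setoid

  ∑≡sum : ∀ {n} (f : Fin n → Carrier) → ∑ f ≡ sum f
  ∑≡sum {zero}  f = ≡.refl
  ∑≡sum {suc n} f = ≡.cong (f zero +_) (∑≡sum (f ∘ suc))

  ∑∑≡sum-sum : ∀ {m n} (f : Fin m → Fin n → Carrier) → ∑ (λ u → ∑ (f u)) ≡ sum (λ u → sum (f u))
  ∑∑≡sum-sum f = ≡.trans (∑≡sum (λ u → ∑ (f u))) (sum-cong-≗ (λ u → ∑≡sum (f u)))

  ∑-zero : ∀ {n} {f : Fin n → Carrier} → (∀ v → f v ≈ 0#) → ∑ f ≈ 0#
  ∑-zero {f = f} f≈0 = trans (reflexive (∑≡sum f)) (sum-zero f≈0)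

  rowSum-· : ∀ {n} (M N : Matrix n) r → rowSum (M · N) r ≈ sum (λ w → M r w * rowSum N w)
  rowSum-· M N r = begin
    ∑ (λ v → ∑ (λ w → M r w * N w v))      ≡⟨ ∑∑≡sum-sum (λ v w → M r w * N w v) ⟩
    sum (λ v → sum (λ w → M r w * N w v))  ≈⟨ ∑-comm (λ v w → M r w * N w v) ⟩
    sum (λ w → sum (λ v → M r w * N w v))  ≈⟨ sum-cong-≋ (λ w → *-distribˡ-sum (M r w) (N w)) ⟨
    sum (λ w → M r w * sum (N w))          ≡⟨ sum-cong-≗ (λ w → ≡.cong (M r w *_) (∑≡sum (N w))) ⟨
    sum (λ w → M r w * rowSum N w)         ∎

  colSum-· : ∀ {n} (M N : Matrix n) c → colSum (M · N) c ≈ sum (λ w → colSum M w * N w c)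
  colSum-· M N c = begin
    ∑ (λ u → ∑ (λ w → M u w * N w c))      ≡⟨ ∑∑≡sum-sum (λ u w → M u w * N w c) ⟩
    sum (λ u → sum (λ w → M u w * N w c))  ≈⟨ ∑-comm (λ u w → M u w * N w c) ⟩
    sum (λ w → sum (λ u → M u w * N w c))  ≈⟨ sum-cong-≋ (λ w → *-distribʳ-sum (N w c) (λ u → M u w)) ⟨
    sum (λ w → sum (λ u → M u w) * N w c)  ≡⟨ sum-cong-≗ (λ w → ≡.cong (_* N w c) (∑≡sum (λ u → M u w))) ⟨
    sum (λ w → colSum M w * N w c)         ∎

  module _ {n d : ℕ} (S : AssociationScheme n d) (x : Fin n) where
    open Scheme S

    E*-· : ∀ i (M : Matrix n) u v → (E* S x i · M) u v ≈ 𝟙 (rel S x u ≡ᵇ i) * M u v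
    E*-· i M u v = begin
      ∑ f                                       ≡⟨ ∑≡sum f ⟩
      sum f                                     ≈⟨ sum-single f u vanishes ⟩
      𝟙 ((u ≡ᵇ u) ∧ (rel S x u ≡ᵇ i)) * M u v  ≡⟨ ≡.cong (λ b → 𝟙 (b ∧ _) * M u v) (≡ᵇ-true {u = u} ≡.refl) ⟩
      𝟙 (rel S x u ≡ᵇ i) * M u v                ∎
      where
      f : Fin n → Carrier
      f t = 𝟙 ((u ≡ᵇ t) ∧ (rel S x u ≡ᵇ i)) * M t v
      vanishes : ∀ t → t ≢ u → f t ≈ 0#
      vanishes t t≢u = 𝟙-false (≡.cong (_∧ _) (≡ᵇ-false (t≢u ∘ ≡.sym))) _

    ·-E* : ∀ l (M : Matrix n) u v → (M · E* S x l) u v ≈ M u v * 𝟙 (rel S x v ≡ᵇ l)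
    ·-E* l M u v = begin
      ∑ f                                       ≡⟨ ∑≡sum f ⟩
      sum f                                     ≈⟨ sum-single f v vanishes ⟩
      M u v * 𝟙 ((v ≡ᵇ v) ∧ (rel S x v ≡ᵇ l))  ≡⟨ ≡.cong (λ b → M u v * 𝟙 (b ∧ _)) (≡ᵇ-true {u = v} ≡.refl) ⟩
      M u v * 𝟙 (rel S x v ≡ᵇ l)                ∎
      where
      f : Fin n → Carrier
      f w = M u w * 𝟙 ((w ≡ᵇ v) ∧ (rel S x w ≡ᵇ l))
      vanishes : ∀ w → w ≢ v → f w ≈ 0#
      vanishes w w≢v = trans (*-comm _ _) (𝟙-false (≡.cong (_∧ _) (≡ᵇ-false w≢v)) _)

    block≈blockEntry : ∀ i j l u v → block S x (i , j , l) u v ≈ blockEntry S x i j l u v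
    block≈blockEntry i j l u v = trans (·-E* l (E* S x i · A S j) u v) (*-congʳ (E*-· i (A S j) u v))

    record Balanced (i l : Fin (suc d)) (M : Matrix n) (μ : Carrier) : Set ℓ where
      field
        outsideRow : ∀ {u} v → rel S x u ≢ i → M u v ≈ 0#
        outsideCol : ∀ u {v} → rel S x v ≢ l → M u v ≈ 0#
        rowSum≈    : ∀ r → rel S x r ≡ i → rowSum M r ≈ μ
        colSum≈    : ∀ c → rel S x c ≡ l → colSum M c ≈ μ
    open Balanced

    zero-balanced : ∀ {i l} {M : Matrix n} → (∀ u v → M u v ≈ 0#) → Balanced i l M 0#
    zero-balanced M≈0 = record
      { outsideRow = λ v _ → M≈0 _ v
      ; outsideCol = λ u _ → M≈0 u _
      ; rowSum≈    = λ r _ → ∑-zero (M≈0 r)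
      ; colSum≈    = λ c _ → ∑-zero (λ u → M≈0 u c)
      }

    ·-vanishes : ∀ {i l i′ l′ μ ν} {M N : Matrix n} → Balanced i l M μ → Balanced i′ l′ N ν →
      l ≢ i′ → ∀ u v → (M · N) u v ≈ 0#
    ·-vanishes {l = l} {i′} {M = M} {N} BM BN l≢i′ u v = ∑-zero λ w → byCases w (rel S x w ≟ l)
      where
      byCases : ∀ w → Dec (rel S x w ≡ l) → M u w * N w v ≈ 0#
      byCases w (yes xw≡l) = trans (*-congˡ (outsideRow BN v (l≢i′ ∘ ≡.trans (≡.sym xw≡l)))) (zeroʳ _)
      byCases w (no  xw≢l) = trans (*-congʳ (outsideCol BM u xw≢l)) (zeroˡ _)

    ·-balanced : ∀ {i l l′ μ ν} {M N : Matrix n} → Balanced i l M μ → Balanced l l′ N ν →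
      Balanced i l′ (M · N) (μ * ν)
    ·-balanced {i} {l} {l′} {μ} {ν} {M} {N} BM BN = record
      { outsideRow = λ v xu≢i → ∑-zero λ w → trans (*-congʳ (outsideRow BM w xu≢i)) (zeroˡ _)
      ; outsideCol = λ u xv≢l′ → ∑-zero λ w → trans (*-congˡ (outsideCol BN w xv≢l′)) (zeroʳ _)
      ; rowSum≈    = λ r xr≡i → begin
          rowSum (M · N) r                ≈⟨ rowSum-· M N r ⟩
          sum (λ w → M r w * rowSum N w)  ≈⟨ sum-cong-≋ (λ w → rowTerm r w (rel S x w ≟ l)) ⟩
          sum (λ w → M r w * ν)           ≈⟨ *-distribʳ-sum ν (M r) ⟨
          sum (M r) * ν                   ≡⟨ ≡.cong (_* ν) (∑≡sum (M r)) ⟨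
          rowSum M r * ν                  ≈⟨ *-congʳ (rowSum≈ BM r xr≡i) ⟩
          μ * ν                           ∎
      ; colSum≈    = λ c xc≡l′ → begin
          colSum (M · N) c                ≈⟨ colSum-· M N c ⟩
          sum (λ w → colSum M w * N w c)  ≈⟨ sum-cong-≋ (λ w → colTerm c w (rel S x w ≟ l)) ⟩
          sum (λ w → μ * N w c)           ≈⟨ *-distribˡ-sum μ (λ w → N w c) ⟨
          μ * sum (λ w → N w c)           ≡⟨ ≡.cong (μ *_) (∑≡sum (λ w → N w c)) ⟨
          μ * colSum N c                  ≈⟨ *-congˡ (colSum≈ BN c xc≡l′) ⟩
          μ * ν                           ∎
      }
      where
      rowTerm : ∀ r w → Dec (rel S x w ≡ l) → M r w * rowSum N w ≈ M r w * ν
      rowTerm r w (yes xw≡l) = *-congˡ (rowSum≈ BN w xw≡l)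
      rowTerm r w (no  xw≢l) = trans (annihilate _) (sym (annihilate ν))
        where
        annihilate : ∀ y → M r w * y ≈ 0#
        annihilate y = trans (*-congʳ (outsideCol BM r xw≢l)) (zeroˡ y)
      colTerm : ∀ c w → Dec (rel S x w ≡ l) → colSum M w * N w c ≈ μ * N w c
      colTerm c w (yes xw≡l) = *-congʳ (colSum≈ BM w xw≡l)
      colTerm c w (no  xw≢l) = trans (annihilate _) (sym (annihilate μ))
        where
        annihilate : ∀ y → y * N w c ≈ 0#
        annihilate y = trans (*-congˡ (outsideRow BN c xw≢l)) (zeroʳ y)

    balanced-· : ∀ {i l i′ l′} {M N : Matrix n} →
      Σ Carrier (Balanced i l M) → Σ Carrier (Balanced i′ l′ N) → Σ Carrier (Balanced i l′ (M · N))
    balanced-· {l = l} {i′} (μ , BM) (ν , BN) with l ≟ i′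
    ... | yes ≡.refl = μ * ν , ·-balanced BM BN
    ... | no  l≢i′   = 0# , zero-balanced (·-vanishes BM BN l≢i′)

    block-balanced : ∀ i j l → valencyAt S x i ≡ valencyAt S x l →
      Balanced i l (block S x (i , j , l)) (intersectionNumber j (l ᵀ) (i ᵀ) × 1#)
    block-balanced i j l kᵢ≡kₗ = record
      { outsideRow = λ v xu≢i → trans (block≈blockEntry i j l _ v) (blockEntry-outsideRow S x j l v xu≢i)
      ; outsideCol = λ u xv≢l → trans (block≈blockEntry i j l u _) (blockEntry-outsideCol S x i j u xv≢l)
      ; rowSum≈    = λ r xr≡i → begin
          rowSum (block S x (i , j , l)) r       ≡⟨ ∑≡sum (block S x (i , j , l) r) ⟩
          sum (block S x (i , j , l) r)          ≈⟨ sum-cong-≋ (block≈blockEntry i j l r) ⟩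
          sum (blockEntry S x i j l r)           ≈⟨ blockEntry-rowSum S x j l r xr≡i ⟩
          intersectionNumber j (l ᵀ) (i ᵀ) × 1#  ∎
      ; colSum≈    = λ c xc≡l → begin
          colSum (block S x (i , j , l)) c       ≡⟨ ∑≡sum (λ u → block S x (i , j , l) u c) ⟩
          sum (λ u → block S x (i , j , l) u c)  ≈⟨ sum-cong-≋ (λ u → block≈blockEntry i j l u c) ⟩
          sum (λ u → blockEntry S x i j l u c)   ≈⟨ blockEntry-colSum S x i j c xc≡l ⟩
          intersectionNumber i j l × 1#          ≡⟨ ≡.cong (_× 1#) (intersectionNumber-ᵀ S x j c kᵢ≡kₗ xc≡l) ⟨
          intersectionNumber j (l ᵀ) (i ᵀ) × 1#  ∎
      }

    P-balanced : ∀ {a} (ts : Vec (Triple d) (suc a)) →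
      (∀ b → let (i , j , l) = lookup ts b in valencyAt S x i ≡ valencyAt S x l) →
      Σ Carrier (Balanced (firstI ts) (lastL ts) (P S x ts))
    P-balanced ((i , j , l) ∷ [])     kᵢ≡kₗ = _ , block-balanced i j l (kᵢ≡kₗ zero)
    P-balanced ((i , j , l) ∷ t ∷ ts) kᵢ≡kₗ =
      balanced-· (_ , block-balanced i j l (kᵢ≡kₗ zero)) (P-balanced (t ∷ ts) (kᵢ≡kₗ ∘ suc))

lemma3p5 : ∀ {c ℓ : Level} (F : Field c ℓ) (n d : ℕ) (S : AssociationScheme (suc n) d)
           (x : Fin (suc n)) (a : ℕ) (ijl : Vec (Triple d) (suc a)) →
           (∀ (b : Fin (suc a)) → let (i , j , l) = lookup ijl b in valencyAt S x i ≡ valencyAt S x l) →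
           ∀ (r c : Fin (suc n)) → rel S x r ≡ firstI ijl → rel S x c ≡ lastL ijl →
           Field._≈_ F (Matrices.rowSum F (Matrices.P F S x ijl) r) (Matrices.colSum F (Matrices.P F S x ijl) c)
lemma3p5 F n d S x a ijl kᵢ≡kₗ r c xr≡i₀ xc≡lₐ with P-balanced F S x ijl kᵢ≡kₗ
... | _ , B = Field.trans F (Balanced.rowSum≈ B r xr≡i₀) (Field.sym F (Balanced.colSum≈ B c xc≡lₐ))
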